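{- Let $k \ge 0$ be an integer and let $G$ be a finite simple graph on $n \ge 1$ vertices with average degree $d(G)$. Then $\alpha_k(G) > \frac{k+1}{d(G)+2k+2}\, n$.
   Context: For an integer $k \ge 0$, a $k$-independent set of a graph $G=(V,E)$ is a set $S \subseteq V$ such that the subgraph induced by $S$ has maximum degree at most $k$; $\alpha_k(G)$ is the maximum cardinality of a $k$-independent set of $G$. The average degree of $G$ is $d(G) = \frac{1}{n}\sum_{v \in V}\deg(v)$. -}

module Defs where

open import Data.Nat using (ℕ; zero; suc; _+_; _*_; _≤_)
import Data.Nat as N
import Data.Nat.Properties as N
open import Data.Bool using (Bool; true; false; _∧_; if_then_else_)
open import Data.Fin using (Fin)
open import Data.Fin.Subset using (Subset; _∈_)
open import Data.Vec using (lookup)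
open import Data.List using (List; map; allFin)
open import Data.Nat.ListAction using (sum)
open import Data.Product using (_×_; ∃; _,_)
open import Relation.Binary.PropositionalEquality using (_≡_)
open import Data.Integer using (+_)
open import Data.Rational using (ℚ; _/_; _÷_; _<_; NonZero; Positive; NonNegative)
import Data.Rational as Q
open import Data.Rational.Properties using (normalize-nonNeg; nonNeg+pos⇒pos; pos⇒nonZero; normalize-pos)
open import Data.Fin.Subset using (∣_∣)

record Graph (n : ℕ) : Set where
  field
    adj   : Fin n → Fin n → Bool
    sym   : ∀ u v → adj u v ≡ adj v u
    irrefl : ∀ v → adj v v ≡ false
open Graph public

countAdj : ∀ {n} → Graph n → (Fin n → Bool) → Fin n → ℕ
countAdj {n} G p v =
  sum (map (λ u → if adj G v u ∧ p u then 1 else 0) (allFin n))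

deg : ∀ {n} → Graph n → Fin n → ℕ
deg G v = countAdj G (λ _ → true) v

degIn : ∀ {n} → Graph n → Subset n → Fin n → ℕ
degIn G S v = countAdj G (λ u → member u) v
  where
    member : _ → Bool
    member u = lookup S u

degSum : ∀ {n} → Graph n → ℕ
degSum {n} G = sum (map (deg G) (allFin n))

avgDeg : ∀ {n} → Graph (suc n) → ℚ
avgDeg {n} G = (+ degSum G) / suc n

IsKIndependent : ∀ {n} → ℕ → Graph n → Subset n → Set
IsKIndependent k G S = ∀ v → v ∈ S → degIn G S v ≤ k

ℕ→ℚ : ℕ → ℚ
ℕ→ℚ m = (+ m) / 1

bound : ∀ {n} → ℕ → Graph (suc n) → ℚ
bound {n} k G =
  (ℕ→ℚ (suc k) ÷ denom) {{pos⇒nonZero denom {{pos}}}} Q.* ℕ→ℚ (suc n)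
  where
    denom : ℚ
    denom = avgDeg G Q.+ ℕ→ℚ (2 * k + 2)
    pos : Positive denom
    pos = nonNeg+pos⇒pos (avgDeg G) {{normalize-nonNeg (degSum G) (suc n)}}
            (ℕ→ℚ (2 * k + 2)) {{normalize-pos (2 * k + 2) 1 {{_}} {{N.>-nonZero (N.≤-trans (N.s≤s N.z≤n) (N.m≤n+m 2 (2 * k)))}}}}

module Submission where

-- Write K = k + 1 and, for a vertex set W with m vertices whose induced subgraph has degree sum
-- e(W), f(W) = K m² / (e(W) + 2Km); for W = V this is the bound (k + 1) n / (d(G) + 2k + 2).
-- Deleting a vertex whose degree in G[W] is at least e(W)/m + K does not decrease f, so by
-- induction on |W| it suffices to treat sets W in which every degree is below e(W)/m + K.
-- There, a local search decreasing (2k + 1)|V ∖ S| + e(S) ends in an S ⊆ W whose vertices have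
-- at most k neighbours in S, while every vertex of W ∖ S has more than k. Counting the edges
-- between S and W ∖ S gives K (m − |S|) < |S| (e(W)/m + K), that is |S| > f(W).

open import Defs hiding (sym)
open import Data.Nat using (ℕ; suc)
open import Data.Fin.Subset using (Subset; ∣_∣)
open import Data.Product using (∃; _×_; _,_)

-- The order on ℕ is kept out of the top-level scope, where _<_ is the order on ℚ used in the statement.
module SparseSubsets where

  open import Data.Bool using (Bool; true; false; not; _∧_; if_then_else_)
  open import Data.Fin using (Fin; zero; suc)
  open import Data.Fin.Properties using (_≟_; any?)
  open import Data.Fin.Subset using (inside; outside; _∈_; _∉_; _⊆_; ⁅_⁆; ⊤; ⊥; ∁; _∩_)
  open import Data.Fin.Subset.Properties
    using (_∈?_; x∈⁅x⁆; x≢y⇒x∉⁅y⁆; ∣⁅x⁆∣≡1; ∣⊤∣≡n; ⊥⊆; ⊆-trans; x∈p∩q⁻; x∈∁p⇒x∉p)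
  open import Data.List using (map; allFin; tabulate)
  import Data.List.Properties as List
  import Data.Nat.ListAction as List
  open import Data.Nat using (zero; _+_; _*_; _≤_; _<_; _≰_; z≤n; s≤s; _<?_; _≤?_; >-nonZero)
  open import Data.Nat.Induction using (<-wellFounded)
  open import Data.Nat.Properties hiding (_≟_)
  open import Algebra.Properties.Semiring.Sum +-*-semiring
    using (sum; sum-syntax; sum-replicate-zero; sum-cong-≗; ∑-distrib-+; ∑-comm; *-distribˡ-sum; *-distribʳ-sum)
  open import Data.Nat.Solver using (module +-*-Solver)
  open +-*-Solver using (solve; _:*_; _:+_; _:=_; con)
  open import Data.Vec using ([]; _∷_; lookup; _[_]≔_)
  open import Data.Vec.Functional using (Vector)
  open import Data.Vec.Properties
    using (lookup∘update; lookup∘update′; []≔-lookup; []=⇒lookup; lookup⇒[]=; lookup-zipWith; lookup-map; lookup-replicate; map-[]≔)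
  import Data.Integer as ℤ
  import Data.Integer.Properties as ℤ
  open import Data.Rational using (toℚᵘ; 1/_; 1ℚ; _/_)
  import Data.Rational as ℚ
  import Data.Rational.Properties as ℚ
  import Data.Rational.Solver as ℚ
  open ℚ.+-*-Solver using () renaming (solve to ℚ-solve; _:+_ to _⊕_; _:*_ to _⊗_; _:=_ to _⊜_)
  import Data.Rational.Unnormalised as ℚᵘ
  import Data.Rational.Unnormalised.Properties as ℚᵘ
  open import Function using (_∘_; id)
  open import Induction.WellFounded using (Acc; acc)
  open import Relation.Binary.PropositionalEquality
  open import Relation.Nullary using (yes; no; ¬?; contradiction)
  open import Relation.Nullary.Decidable using (_×-dec_)

  +-≡-cancel-< : ∀ {a b x y} → a + x ≡ b + y → y < x → a < b
  +-≡-cancel-< {a} {b} {x} {y} eq y<x = +-cancelʳ-< x a b (subst (_< b + x) (sym eq) (+-monoʳ-< b y<x))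

  +-≤-*⇒< : ∀ {a s x} → 0 < a → a + s ≤ s * x → a < s * x
  +-≤-*⇒< {a} {zero}  0<a a≤0   = contradiction (<-≤-trans 0<a (≤-trans (m≤m+n a 0) a≤0)) (n≮n 0)
  +-≤-*⇒< {a} {suc s} _   a+s≤x = <-≤-trans (m<m+n a (s≤s z≤n)) a+s≤x

  square-ratio-≤ : ∀ c Y t → Y + 2 * t ≤ suc c * t → suc c * suc c * Y ≤ c * c * (Y + 2 * t)
  square-ratio-≤ zero Y t h = begin
    1 * 1 * Y    ≡⟨ *-identityˡ Y ⟩
    Y            ≤⟨ m≤m+n Y t ⟩
    Y + t        ≤⟨ +-cancelʳ-≤ t (Y + t) 0 (begin
                      Y + t + t    ≡⟨ solve 2 (λ Y t → Y :+ t :+ t := Y :+ con 2 :* t) refl Y t ⟩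
                      Y + 2 * t    ≤⟨ h ⟩
                      1 * t        ≡⟨ *-identityˡ t ⟩
                      0 + t        ∎) ⟩
    0            ∎
    where open ≤-Reasoning
  square-ratio-≤ (suc c) Y t h = begin
    (2 + c) * (2 + c) * Y                           ≡⟨ solve 3 (λ c Y t → (con 2 :+ c) :* (con 2 :+ c) :* Y
                                                      := (con 1 :+ c) :* (con 1 :+ c) :* Y :+ (con 3 :+ con 2 :* c) :* Y) refl c Y t ⟩
    (1 + c) * (1 + c) * Y + (3 + 2 * c) * Y         ≤⟨ +-monoʳ-≤ ((1 + c) * (1 + c) * Y) (*-monoʳ-≤ (3 + 2 * c) Y≤ct) ⟩
    (1 + c) * (1 + c) * Y + (3 + 2 * c) * (c * t)   ≤⟨ +-monoʳ-≤ ((1 + c) * (1 + c) * Y) (≤-trans (≤-reflexive (sym (*-assoc (3 + 2 * c) c t)))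
                                                         (*-monoˡ-≤ t (m≤m+n ((3 + 2 * c) * c) (2 + c)))) ⟩
    (1 + c) * (1 + c) * Y + ((3 + 2 * c) * c + (2 + c)) * t
                                                    ≡⟨ solve 3 (λ c Y t → (con 1 :+ c) :* (con 1 :+ c) :* Y :+ ((con 3 :+ con 2 :* c) :* c :+ (con 2 :+ c)) :* t
                                                      := (con 1 :+ c) :* (con 1 :+ c) :* (Y :+ con 2 :* t)) refl c Y t ⟩
    (1 + c) * (1 + c) * (Y + 2 * t)                 ∎
    where
    open ≤-Reasoning
    Y≤ct : Y ≤ c * t
    Y≤ct = +-cancelʳ-≤ (2 * t) Y (c * t) (≤-trans h (≤-reflexive
             (solve 2 (λ c t → (con 2 :+ c) :* t := c :* t :+ con 2 :* t) refl c t)))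

  ratio-step : ∀ K s c Y t → Y + 2 * t ≤ suc c * t → K * (c * c) < s * Y →
               K * (suc c * suc c) < s * (Y + 2 * t)
  ratio-step K s c zero        t _ ih = contradiction (subst (K * (c * c) <_) (*-zeroʳ s) ih) λ ()
  ratio-step K s c Y@(suc _) t h ih = *-cancelʳ-< Y (K * (suc c * suc c)) (s * X) (begin-strict
    K * (suc c * suc c) * Y    ≡⟨ *-assoc K _ Y ⟩
    K * (suc c * suc c * Y)    ≤⟨ *-monoʳ-≤ K (square-ratio-≤ c Y t h) ⟩
    K * (c * c * X)            ≡⟨ *-assoc K (c * c) X ⟨
    K * (c * c) * X            <⟨ *-monoˡ-< X ih ⟩
    s * Y * X                  ≡⟨ solve 3 (λ s Y X → s :* Y :* X := s :* X :* Y) refl s Y X ⟩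
    s * X * Y                  ∎)
    where
    open ≤-Reasoning
    X = Y + 2 * t

  ratio-step-deletion : ∀ K s c e Δ → (e + 2 * Δ) + K * suc c ≤ suc c * Δ →
    K * (c * c) < s * (e + 2 * (K * c)) → K * (suc c * suc c) < s * ((e + 2 * Δ) + 2 * (K * suc c))
  ratio-step-deletion K s c e Δ high ih =
    subst (λ X → K * (suc c * suc c) < s * X) X≡ (ratio-step K s c (e + 2 * (K * c)) (Δ + K) high′ ih)
    where
    open ≤-Reasoning
    X≡ : (e + 2 * (K * c)) + 2 * (Δ + K) ≡ (e + 2 * Δ) + 2 * (K * suc c)
    X≡ = solve 4 (λ K c e Δ → e :+ con 2 :* (K :* c) :+ con 2 :* (Δ :+ K)
                             := e :+ con 2 :* Δ :+ con 2 :* (K :* (con 1 :+ c))) refl K c e Δ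
    high′ : (e + 2 * (K * c)) + 2 * (Δ + K) ≤ suc c * (Δ + K)
    high′ = begin
      (e + 2 * (K * c)) + 2 * (Δ + K)             ≡⟨ solve 4 (λ K c e Δ → e :+ con 2 :* (K :* c) :+ con 2 :* (Δ :+ K)
                                                       := e :+ con 2 :* Δ :+ K :* (con 1 :+ c) :+ K :* (con 1 :+ c)) refl K c e Δ ⟩
      (e + 2 * Δ) + K * suc c + K * suc c         ≤⟨ +-monoˡ-≤ (K * suc c) high ⟩
      suc c * Δ + K * suc c                       ≡⟨ solve 3 (λ K c Δ → (con 1 :+ c) :* Δ :+ K :* (con 1 :+ c)
                                                       := (con 1 :+ c) :* (Δ :+ K)) refl K c Δ ⟩
      suc c * (Δ + K)                             ∎

  singleton-not-high-degree : ∀ e Δ k → (e + 2 * Δ) + suc k * 1 ≰ 1 * Δ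
  singleton-not-high-degree e Δ k high = n≮n Δ (begin-strict
    Δ                            <⟨ s≤s (m≤m+n Δ (e + Δ + k * 1)) ⟩
    suc (Δ + (e + Δ + k * 1))    ≡⟨ solve 3 (λ e Δ k → con 1 :+ (Δ :+ (e :+ Δ :+ k :* con 1))
                                      := e :+ con 2 :* Δ :+ (con 1 :+ k) :* con 1) refl e Δ k ⟩
    (e + 2 * Δ) + suc k * 1      ≤⟨ high ⟩
    1 * Δ                        ≡⟨ *-identityˡ Δ ⟩
    Δ                            ∎)
    where open ≤-Reasoning

  ∑-mono-≤ : ∀ {n} {f g : Vector ℕ n} → (∀ i → f i ≤ g i) → sum f ≤ sum g
  ∑-mono-≤ {zero}  f≤g = z≤n
  ∑-mono-≤ {suc n} f≤g = +-mono-≤ (f≤g zero) (∑-mono-≤ (f≤g ∘ suc))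

  sum-tabulate : ∀ {n} (f : Vector ℕ n) → List.sum (tabulate f) ≡ sum f
  sum-tabulate {zero}  f = refl
  sum-tabulate {suc n} f = cong (f zero +_) (sum-tabulate (f ∘ suc))

  sum-map-allFin : ∀ {n} (f : Vector ℕ n) → List.sum (map f (allFin n)) ≡ sum f
  sum-map-allFin f = trans (cong List.sum (List.map-tabulate id f)) (sum-tabulate f)

  ∑-*-affine : ∀ {n} (f g : Vector ℕ n) a b →
               ∑[ v < n ] (f v * (a * g v + b)) ≡ a * ∑[ v < n ] (f v * g v) + b * sum f
  ∑-*-affine {n} f g a b = begin
    ∑[ v < n ] (f v * (a * g v + b))             ≡⟨ sum-cong-≗ {n} (λ v → distrib (f v) (g v)) ⟩
    ∑[ v < n ] (a * (f v * g v) + b * f v)       ≡⟨ ∑-distrib-+ (λ v → a * (f v * g v)) (λ v → b * f v) ⟩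
    ∑[ v < n ] (a * (f v * g v)) + ∑[ v < n ] (b * f v)
                                                 ≡⟨ cong₂ _+_ (*-distribˡ-sum a (λ v → f v * g v)) (*-distribˡ-sum b f) ⟨
    a * ∑[ v < n ] (f v * g v) + b * sum f       ∎
    where
    open ≡-Reasoning
    distrib : ∀ x y → x * (a * y + b) ≡ a * (x * y) + b * x
    distrib x y = solve 4 (λ x y a b → x :* (a :* y :+ b) := a :* (x :* y) :+ b :* x) refl x y a b

  𝟙 : Bool → ℕ
  𝟙 b = if b then 1 else 0

  𝟙-∧ : ∀ a b → 𝟙 (a ∧ b) ≡ 𝟙 a * 𝟙 b
  𝟙-∧ true  b = sym (*-identityˡ (𝟙 b))
  𝟙-∧ false b = refl

  χ : ∀ {n} → Subset n → Vector ℕ n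
  χ p x = 𝟙 (lookup p x)

  χ-∈ : ∀ {n} {p : Subset n} {x} → x ∈ p → χ p x ≡ 1
  χ-∈ x∈p = cong 𝟙 ([]=⇒lookup x∈p)

  lookup-∉ : ∀ {n} {p : Subset n} {x} → x ∉ p → lookup p x ≡ outside
  lookup-∉ {p = p} {x} x∉p with lookup p x in eq
  ... | true  = contradiction (lookup⇒[]= x p eq) x∉p
  ... | false = refl

  χ-∉ : ∀ {n} {p : Subset n} {x} → x ∉ p → χ p x ≡ 0
  χ-∉ x∉p = cong 𝟙 (lookup-∉ x∉p)

  []≔inside-∈ : ∀ {n} {p : Subset n} {w} → w ∈ p → p [ w ]≔ inside ≡ p
  []≔inside-∈ {p = p} {w} w∈p = trans (cong (p [ w ]≔_) (sym ([]=⇒lookup w∈p))) ([]≔-lookup p w)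

  []≔outside-∉ : ∀ {n} {p : Subset n} {w} → w ∉ p → p [ w ]≔ outside ≡ p
  []≔outside-∉ {p = p} {w} w∉p = trans (cong (p [ w ]≔_) (sym (lookup-∉ w∉p))) ([]≔-lookup p w)

  []≔outside-⊆ : ∀ {n} (p : Subset n) w → p [ w ]≔ outside ⊆ p
  []≔outside-⊆ p w {x} x∈p⁻ with x ≟ w
  ... | yes refl = contradiction (trans (sym ([]=⇒lookup x∈p⁻)) (lookup∘update w p outside)) λ ()
  ... | no x≢w   = lookup⇒[]= x p (trans (sym (lookup∘update′ x≢w p outside)) ([]=⇒lookup x∈p⁻))

  []≔inside-⊆ : ∀ {n} {p q : Subset n} {w} → w ∈ q → p ⊆ q → p [ w ]≔ inside ⊆ q
  []≔inside-⊆ {p = p} {q} {w} w∈q p⊆q {x} x∈p⁺ with x ≟ w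
  ... | yes refl = w∈q
  ... | no x≢w   = p⊆q (lookup⇒[]= x p (trans (sym (lookup∘update′ x≢w p inside)) ([]=⇒lookup x∈p⁺)))

  ∣p∣≡∑χ : ∀ {n} (p : Subset n) → ∣ p ∣ ≡ sum (χ p)
  ∣p∣≡∑χ []            = refl
  ∣p∣≡∑χ (inside  ∷ p) = cong suc (∣p∣≡∑χ p)
  ∣p∣≡∑χ (outside ∷ p) = ∣p∣≡∑χ p

  ∑χ⁅⁆-* : ∀ {n} (w : Fin n) (f : Vector ℕ n) → ∑[ x < n ] (χ ⁅ w ⁆ x * f x) ≡ f w
  ∑χ⁅⁆-* {suc n} zero    f = begin
    1 * f zero + ∑[ x < n ] (χ ⊥ x * f (suc x))  ≡⟨ cong₂ _+_ (*-identityˡ (f zero)) (sum-cong-≗ {n} χ⊥-*) ⟩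
    f zero + sum {n} (λ _ → 0)                   ≡⟨ cong (f zero +_) (sum-replicate-zero n) ⟩
    f zero + 0                                   ≡⟨ +-identityʳ (f zero) ⟩
    f zero                                       ∎
    where
    open ≡-Reasoning
    χ⊥-* : ∀ x → χ ⊥ x * f (suc x) ≡ 0
    χ⊥-* x = cong (λ b → 𝟙 b * f (suc x)) (lookup-replicate x outside)
  ∑χ⁅⁆-* {suc n} (suc w) f = ∑χ⁅⁆-* w (f ∘ suc)

  χ-[]≔ : ∀ {n} (p : Subset n) (w x : Fin n) →
          χ (p [ w ]≔ inside) x ≡ χ (p [ w ]≔ outside) x + χ ⁅ w ⁆ x
  χ-[]≔ p w x with x ≟ w
  ... | yes refl rewrite lookup∘update w p inside | lookup∘update w p outside = sym (χ-∈ (x∈⁅x⁆ w))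
  ... | no x≢w rewrite lookup∘update′ x≢w p inside | lookup∘update′ x≢w p outside
                     | χ-∉ (x≢y⇒x∉⁅y⁆ x≢w) = sym (+-identityʳ _)

  ∣[]≔inside∣ : ∀ {n} (p : Subset n) w → ∣ p [ w ]≔ inside ∣ ≡ suc ∣ p [ w ]≔ outside ∣
  ∣[]≔inside∣ {n} p w = begin
    ∣ p [ w ]≔ inside ∣                              ≡⟨ ∣p∣≡∑χ (p [ w ]≔ inside) ⟩
    sum (χ (p [ w ]≔ inside))                        ≡⟨ sum-cong-≗ {n} (χ-[]≔ p w) ⟩
    ∑[ x < n ] (χ (p [ w ]≔ outside) x + χ ⁅ w ⁆ x)  ≡⟨ ∑-distrib-+ (χ (p [ w ]≔ outside)) (χ ⁅ w ⁆) ⟩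
    sum (χ (p [ w ]≔ outside)) + sum (χ ⁅ w ⁆)       ≡⟨ cong₂ _+_ (∣p∣≡∑χ (p [ w ]≔ outside)) (∣p∣≡∑χ ⁅ w ⁆) ⟨
    ∣ p [ w ]≔ outside ∣ + ∣ ⁅ w ⁆ ∣                 ≡⟨ cong (∣ p [ w ]≔ outside ∣ +_) (∣⁅x⁆∣≡1 w) ⟩
    ∣ p [ w ]≔ outside ∣ + 1                         ≡⟨ +-comm _ 1 ⟩
    suc ∣ p [ w ]≔ outside ∣                         ∎
    where open ≡-Reasoning

  ∑χ-* : ∀ {n} (p : Subset n) c → ∑[ x < n ] (χ p x * c) ≡ ∣ p ∣ * c
  ∑χ-* p c = trans (sym (*-distribʳ-sum c (χ p))) (cong (_* c) (sym (∣p∣≡∑χ p)))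

  ∑χ-mono-≤ : ∀ {n} (p : Subset n) {f g : Vector ℕ n} → (∀ {x} → x ∈ p → f x ≤ g x) →
              ∑[ x < n ] (χ p x * f x) ≤ ∑[ x < n ] (χ p x * g x)
  ∑χ-mono-≤ p {f} {g} f≤g = ∑-mono-≤ pointwise
    where
    pointwise : ∀ x → χ p x * f x ≤ χ p x * g x
    pointwise x with lookup p x in eq
    ... | true  = +-monoˡ-≤ 0 (f≤g (lookup⇒[]= x p eq))
    ... | false = z≤n

  ∈∩∁⁻ : ∀ {n} (p q : Subset n) {x} → x ∈ p ∩ ∁ q → x ∈ p × x ∉ q
  ∈∩∁⁻ p q x∈ with x∈p , x∈∁q ← x∈p∩q⁻ p (∁ q) x∈ = x∈p , x∈∁p⇒x∉p x∈∁q

  χ-∩∁ : ∀ {n} {p q : Subset n} → q ⊆ p → ∀ x → χ p x ≡ χ q x + χ (p ∩ ∁ q) x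
  χ-∩∁ {p = p} {q} q⊆p x rewrite lookup-zipWith _∧_ x p (∁ q) | lookup-map x not q
    with lookup p x in ep | lookup q x in eq
  ... | true  | true  = refl
  ... | true  | false = refl
  ... | false | false = refl
  ... | false | true  = contradiction (trans (sym ([]=⇒lookup (q⊆p (lookup⇒[]= x q eq)))) ep) λ ()

  module _ {n : ℕ} (G : Graph n) where

    -- With A the adjacency matrix, degTo g = A g and ⟪ f , g ⟫ = fᵀ A g; for indicator vectors
    -- degTo (χ S) v is the number of neighbours of v in S and ⟪ χ S , χ S ⟫ = 2 |E(G[S])|.
    A : Fin n → Fin n → ℕ
    A v u = 𝟙 (adj G v u)

    degTo : Vector ℕ n → Vector ℕ n
    degTo g v = ∑[ u < n ] (A v u * g u)

    ⟪_,_⟫ : Vector ℕ n → Vector ℕ n → ℕ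
    ⟪ f , g ⟫ = ∑[ v < n ] (f v * degTo g v)

    A-sym : ∀ v u → A v u ≡ A u v
    A-sym v u = cong 𝟙 (Graph.sym G v u)

    A-irrefl : ∀ v → A v v ≡ 0
    A-irrefl v = cong 𝟙 (irrefl G v)

    degTo-cong : ∀ {g h} → g ≗ h → degTo g ≗ degTo h
    degTo-cong g≗h v = sum-cong-≗ {n} λ u → cong (A v u *_) (g≗h u)

    degTo-mono-≤ : ∀ {g h} → (∀ u → g u ≤ h u) → ∀ v → degTo g v ≤ degTo h v
    degTo-mono-≤ g≤h v = ∑-mono-≤ λ u → *-monoʳ-≤ (A v u) (g≤h u)

    degTo-+ : ∀ g h v → degTo (λ u → g u + h u) v ≡ degTo g v + degTo h v
    degTo-+ g h v = trans (sum-cong-≗ {n} λ u → *-distribˡ-+ (A v u) (g u) (h u)) (∑-distrib-+ (λ u → A v u * g u) (λ u → A v u * h u))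

    degTo-χ⁅⁆ : ∀ w v → degTo (χ ⁅ w ⁆) v ≡ A v w
    degTo-χ⁅⁆ w v = trans (sum-cong-≗ {n} λ u → *-comm (A v u) (χ ⁅ w ⁆ u)) (∑χ⁅⁆-* w (A v))

    ⟪⟫-cong : ∀ {f f′ g g′} → f ≗ f′ → g ≗ g′ → ⟪ f , g ⟫ ≡ ⟪ f′ , g′ ⟫
    ⟪⟫-cong f≗f′ g≗g′ = sum-cong-≗ {n} λ v → cong₂ _*_ (f≗f′ v) (degTo-cong g≗g′ v)

    ⟪⟫-comm : ∀ f g → ⟪ f , g ⟫ ≡ ⟪ g , f ⟫
    ⟪⟫-comm f g = begin
      ∑[ v < n ] (f v * ∑[ u < n ] (A v u * g u))  ≡⟨ sum-cong-≗ {n} (λ v → *-distribˡ-sum (f v) (λ u → A v u * g u)) ⟩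
      ∑[ v < n ] ∑[ u < n ] (f v * (A v u * g u))  ≡⟨ ∑-comm (λ v u → f v * (A v u * g u)) ⟩
      ∑[ u < n ] ∑[ v < n ] (f v * (A v u * g u))  ≡⟨ sum-cong-≗ {n} (λ u → sum-cong-≗ {n} λ v → swap (f v) (g u) (A-sym v u)) ⟩
      ∑[ u < n ] ∑[ v < n ] (g u * (A u v * f v))  ≡⟨ sum-cong-≗ {n} (λ u → *-distribˡ-sum (g u) (λ v → A u v * f v)) ⟨
      ∑[ u < n ] (g u * ∑[ v < n ] (A u v * f v))  ∎
      where
      open ≡-Reasoning
      swap : ∀ x y {a b} → a ≡ b → x * (a * y) ≡ y * (b * x)
      swap x y {a} refl = solve 3 (λ x y a → x :* (a :* y) := y :* (a :* x)) refl x y a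

    ⟪⟫-monoʳ-≤ : ∀ f {g h} → (∀ u → g u ≤ h u) → ⟪ f , g ⟫ ≤ ⟪ f , h ⟫
    ⟪⟫-monoʳ-≤ f g≤h = ∑-mono-≤ λ v → *-monoʳ-≤ (f v) (degTo-mono-≤ g≤h v)

    ⟪⟫-distribˡ-+ : ∀ f f′ g → ⟪ (λ v → f v + f′ v) , g ⟫ ≡ ⟪ f , g ⟫ + ⟪ f′ , g ⟫
    ⟪⟫-distribˡ-+ f f′ g = trans (sum-cong-≗ {n} λ v → *-distribʳ-+ (degTo g v) (f v) (f′ v))
                                 (∑-distrib-+ (λ v → f v * degTo g v) (λ v → f′ v * degTo g v))

    ⟪⟫-distribʳ-+ : ∀ f g g′ → ⟪ f , (λ v → g v + g′ v) ⟫ ≡ ⟪ f , g ⟫ + ⟪ f , g′ ⟫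
    ⟪⟫-distribʳ-+ f g g′ = begin
      ⟪ f , (λ v → g v + g′ v) ⟫  ≡⟨ ⟪⟫-comm f _ ⟩
      ⟪ (λ v → g v + g′ v) , f ⟫  ≡⟨ ⟪⟫-distribˡ-+ g g′ f ⟩
      ⟪ g , f ⟫ + ⟪ g′ , f ⟫      ≡⟨ cong₂ _+_ (⟪⟫-comm g f) (⟪⟫-comm g′ f) ⟩
      ⟪ f , g ⟫ + ⟪ f , g′ ⟫      ∎
      where open ≡-Reasoning

    ⟪χ⁅⁆,_⟫ : ∀ g {w} → ⟪ χ ⁅ w ⁆ , g ⟫ ≡ degTo g w
    ⟪χ⁅⁆, g ⟫ {w} = ∑χ⁅⁆-* w (degTo g)

    ⟪_,χ⁅⁆⟫ : ∀ f {w} → ⟪ f , χ ⁅ w ⁆ ⟫ ≡ degTo f w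
    ⟪ f ,χ⁅⁆⟫ {w} = trans (⟪⟫-comm f (χ ⁅ w ⁆)) ⟪χ⁅⁆, f ⟫

    ⟪⟫-+χ⁅⁆ : ∀ g w → let g⁺ = λ v → g v + χ ⁅ w ⁆ v in ⟪ g⁺ , g⁺ ⟫ ≡ ⟪ g , g ⟫ + 2 * degTo g w
    ⟪⟫-+χ⁅⁆ g w = begin
      ⟪ g⁺ , g⁺ ⟫                                      ≡⟨ ⟪⟫-distribˡ-+ g δ g⁺ ⟩
      ⟪ g , g⁺ ⟫ + ⟪ δ , g⁺ ⟫                          ≡⟨ cong₂ _+_ (⟪⟫-distribʳ-+ g g δ) (⟪⟫-distribʳ-+ δ g δ) ⟩
      (⟪ g , g ⟫ + ⟪ g , δ ⟫) + (⟪ δ , g ⟫ + ⟪ δ , δ ⟫)  ≡⟨ cong₂ (λ a b → (⟪ g , g ⟫ + a) + (⟪ δ , g ⟫ + b)) ⟪ g ,χ⁅⁆⟫ ⟪ δ ,χ⁅⁆⟫ ⟩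
      (⟪ g , g ⟫ + d) + (⟪ δ , g ⟫ + degTo δ w)        ≡⟨ cong₂ (λ a b → (⟪ g , g ⟫ + d) + (a + b)) ⟪χ⁅⁆, g ⟫ (degTo-χ⁅⁆ w w) ⟩
      (⟪ g , g ⟫ + d) + (d + A w w)                    ≡⟨ cong (λ a → (⟪ g , g ⟫ + d) + (d + a)) (A-irrefl w) ⟩
      (⟪ g , g ⟫ + d) + (d + 0)                        ≡⟨ solve 2 (λ e d → (e :+ d) :+ (d :+ con 0) := e :+ con 2 :* d) refl ⟪ g , g ⟫ d ⟩
      ⟪ g , g ⟫ + 2 * d                                ∎
      where
      open ≡-Reasoning
      δ = χ ⁅ w ⁆
      g⁺ = λ v → g v + δ v
      d = degTo g w

    degSumIn : Subset n → ℕ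
    degSumIn S = ⟪ χ S , χ S ⟫

    degSumIn-[]≔ : ∀ p w → degSumIn (p [ w ]≔ inside)
                           ≡ degSumIn (p [ w ]≔ outside) + 2 * degTo (χ (p [ w ]≔ outside)) w
    degSumIn-[]≔ p w = trans (⟪⟫-cong (χ-[]≔ p w) (χ-[]≔ p w)) (⟪⟫-+χ⁅⁆ (χ (p [ w ]≔ outside)) w)

    degTo-[]≔ : ∀ p w → degTo (χ (p [ w ]≔ inside)) w ≡ degTo (χ (p [ w ]≔ outside)) w
    degTo-[]≔ p w = begin
      degTo (χ (p [ w ]≔ inside)) w                                ≡⟨ degTo-cong (χ-[]≔ p w) w ⟩
      degTo (λ x → χ (p [ w ]≔ outside) x + χ ⁅ w ⁆ x) w           ≡⟨ degTo-+ (χ (p [ w ]≔ outside)) (χ ⁅ w ⁆) w ⟩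
      degTo (χ (p [ w ]≔ outside)) w + degTo (χ ⁅ w ⁆) w           ≡⟨ cong (degTo (χ (p [ w ]≔ outside)) w +_) (trans (degTo-χ⁅⁆ w w) (A-irrefl w)) ⟩
      degTo (χ (p [ w ]≔ outside)) w + 0                           ≡⟨ +-identityʳ _ ⟩
      degTo (χ (p [ w ]≔ outside)) w                               ∎
      where open ≡-Reasoning

    countAdj-degTo : ∀ p v → countAdj G p v ≡ degTo (𝟙 ∘ p) v
    countAdj-degTo p v = trans (sum-map-allFin (λ u → 𝟙 (adj G v u ∧ p u)))
                               (sum-cong-≗ {n} λ u → 𝟙-∧ (adj G v u) (p u))

    degIn-degTo : ∀ S v → degIn G S v ≡ degTo (χ S) v
    degIn-degTo S v = countAdj-degTo (lookup S) v

    degSum-degSumIn : degSum G ≡ degSumIn ⊤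
    degSum-degSumIn = begin
      List.sum (map (deg G) (allFin n))     ≡⟨ sum-map-allFin (deg G) ⟩
      ∑[ v < n ] deg G v                    ≡⟨ sum-cong-≗ {n} (λ v → trans (countAdj-degTo (λ _ → true) v) (sym (degTo-cong χ⊤ v))) ⟩
      ∑[ v < n ] degTo (χ ⊤) v              ≡⟨ sum-cong-≗ {n} (λ v → trans (cong (_* degTo (χ ⊤) v) (χ⊤ v)) (*-identityˡ _)) ⟨
      degSumIn ⊤                            ∎
      where
      open ≡-Reasoning
      χ⊤ : ∀ v → χ ⊤ v ≡ 1
      χ⊤ v = cong 𝟙 (lookup-replicate v inside)

    module VertexRemoval {W : Subset n} {v : Fin n} (v∈W : v ∈ W) where

      W′ : Subset n
      W′ = W [ v ]≔ outside

      Δ : ℕ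
      Δ = degTo (χ W′) v

      ∣W∣≡ : ∣ W ∣ ≡ suc ∣ W′ ∣
      ∣W∣≡ = trans (cong ∣_∣ (sym ([]≔inside-∈ v∈W))) (∣[]≔inside∣ W v)

      degSumIn≡ : degSumIn W ≡ degSumIn W′ + 2 * Δ
      degSumIn≡ = trans (cong degSumIn (sym ([]≔inside-∈ v∈W))) (degSumIn-[]≔ W v)

      degTo≡ : degTo (χ W) v ≡ Δ
      degTo≡ = trans (cong (λ T → degTo (χ T) v) (sym ([]≔inside-∈ v∈W))) (degTo-[]≔ W v)

    module _ (k : ℕ) where

      Sparse : Subset n → Set
      Sparse S = ∀ {v} → v ∈ S → degTo (χ S) v ≤ k

      record LocallyOptimalIn (W S : Subset n) : Set where
        field
          ⊆W        : S ⊆ W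
          sparse    : Sparse S
          dominated : ∀ {u} → u ∈ W → u ∉ S → k < degTo (χ S) u

      -- The weight 2k + 1 lies strictly between twice the degree into S of a vertex that may be
      -- added (at most k) and of one that must be removed (more than k).
      potential : Subset n → ℕ
      potential S = (1 + 2 * k) * ∣ ∁ S ∣ + degSumIn S

      potential-[]≔ : ∀ p w → potential (p [ w ]≔ outside) + 2 * degTo (χ (p [ w ]≔ outside)) w
                              ≡ potential (p [ w ]≔ inside) + (1 + 2 * k)
      potential-[]≔ p w = begin
        c * ∣ ∁ p⁻ ∣ + e + 2 * d          ≡⟨ cong (λ m → c * m + e + 2 * d) ∣∁p⁻∣ ⟩
        c * suc ∣ ∁ p⁺ ∣ + e + 2 * d      ≡⟨ solve 4 (λ c a e d → c :* (con 1 :+ a) :+ e :+ con 2 :* d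
                                                    := c :* a :+ (e :+ con 2 :* d) :+ c) refl c ∣ ∁ p⁺ ∣ e d ⟩
        c * ∣ ∁ p⁺ ∣ + (e + 2 * d) + c    ≡⟨ cong (λ m → c * ∣ ∁ p⁺ ∣ + m + c) (degSumIn-[]≔ p w) ⟨
        potential p⁺ + c                  ∎
        where
        open ≡-Reasoning
        p⁺ = p [ w ]≔ inside
        p⁻ = p [ w ]≔ outside
        c = 1 + 2 * k
        e = degSumIn p⁻
        d = degTo (χ p⁻) w
        ∣∁p⁻∣ : ∣ ∁ p⁻ ∣ ≡ suc ∣ ∁ p⁺ ∣
        ∣∁p⁻∣ = begin
          ∣ ∁ p⁻ ∣                 ≡⟨ cong ∣_∣ (map-[]≔ not p w) ⟩
          ∣ ∁ p [ w ]≔ inside ∣    ≡⟨ ∣[]≔inside∣ (∁ p) w ⟩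
          suc ∣ ∁ p [ w ]≔ outside ∣ ≡⟨ cong (suc ∘ ∣_∣) (map-[]≔ not p w) ⟨
          suc ∣ ∁ p⁺ ∣             ∎

      potential-remove : ∀ {S v} → v ∈ S → k < degTo (χ S) v → potential (S [ v ]≔ outside) < potential S
      potential-remove {S} {v} v∈S heavy =
        subst (λ T → potential (S [ v ]≔ outside) < potential T) ([]≔inside-∈ v∈S)
          (+-≡-cancel-< (potential-[]≔ S v) (begin-strict
            1 + 2 * k                              <⟨ n<1+n _ ⟩
            2 + 2 * k                              ≡⟨ *-suc 2 k ⟨
            2 * suc k                              ≤⟨ *-monoʳ-≤ 2 heavy ⟩
            2 * degTo (χ S) v                      ≡⟨ cong (λ T → 2 * degTo (χ T) v) ([]≔inside-∈ v∈S) ⟨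
            2 * degTo (χ (S [ v ]≔ inside)) v      ≡⟨ cong (2 *_) (degTo-[]≔ S v) ⟩
            2 * degTo (χ (S [ v ]≔ outside)) v     ∎))
        where open ≤-Reasoning

      potential-insert : ∀ {S u} → u ∉ S → degTo (χ S) u ≤ k → potential (S [ u ]≔ inside) < potential S
      potential-insert {S} {u} u∉S light =
        subst (λ T → potential (S [ u ]≔ inside) < potential T) ([]≔outside-∉ u∉S)
          (+-≡-cancel-< (sym (potential-[]≔ S u)) (begin-strict
            2 * degTo (χ (S [ u ]≔ outside)) u     ≡⟨ cong (λ T → 2 * degTo (χ T) u) ([]≔outside-∉ u∉S) ⟩
            2 * degTo (χ S) u                      ≤⟨ *-monoʳ-≤ 2 light ⟩
            2 * k                                  <⟨ n<1+n _ ⟩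
            1 + 2 * k                              ∎))
        where open ≤-Reasoning

      locallyOptimalIn : ∀ W → ∃ (LocallyOptimalIn W)
      locallyOptimalIn W = search ⊥ ⊥⊆ (<-wellFounded (potential ⊥))
        where
        search : ∀ S → S ⊆ W → Acc _<_ (potential S) → ∃ (LocallyOptimalIn W)
        search S S⊆W (acc more) with any? (λ v → v ∈? S ×-dec k <? degTo (χ S) v)
        ... | yes (v , v∈S , heavy) =
          search (S [ v ]≔ outside) (⊆-trans ([]≔outside-⊆ S v) S⊆W) (more (potential-remove v∈S heavy))
        ... | no noHeavy with any? (λ u → u ∈? W ×-dec ¬? (u ∈? S) ×-dec degTo (χ S) u ≤? k)
        ...   | yes (u , u∈W , u∉S , light) =
          search (S [ u ]≔ inside) ([]≔inside-⊆ u∈W S⊆W) (more (potential-insert u∉S light))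
        ...   | no noLight = S , record
          { ⊆W        = S⊆W
          ; sparse    = λ v∈S → ≮⇒≥ λ heavy → noHeavy (_ , v∈S , heavy)
          ; dominated = λ u∈W u∉S → ≰⇒> λ light → noLight (_ , u∈W , u∉S , light)
          }

      -- Double counting the edges between S and W ∩ ∁ S: each vertex of W ∩ ∁ S sends more than k of
      -- them, each vertex of S at most its (small) degree in G[W].
      locallyOptimal-bound : ∀ {W S c} → LocallyOptimalIn W S → ∣ W ∣ ≡ suc c →
        (∀ {v} → v ∈ W → suc c * degTo (χ W) v < degSumIn W + suc k * suc c) →
        suc k * (suc c * suc c) < ∣ S ∣ * (degSumIn W + 2 * (suc k * suc c))
      locallyOptimal-bound {W} {S} {c} opt ∣W∣≡m low = +-≤-*⇒< (s≤s z≤n) (begin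
        K * (m * m) + s                  ≡⟨ cong (λ t → K * (m * t) + s) m≡s+r ⟩
        K * (m * (s + r)) + s            ≡⟨ solve 4 (λ K m s r → K :* (m :* (s :+ r)) :+ s
                                              := m :* (K :* r) :+ (K :* m :+ con 1) :* s) refl K m s r ⟩
        m * (K * r) + (K * m + 1) * s    ≤⟨ +-monoˡ-≤ _ (*-monoʳ-≤ m Kr≤P) ⟩
        m * P + (K * m + 1) * s          ≡⟨ cong (λ t → m * P + (K * m + 1) * t) (∣p∣≡∑χ S) ⟩
        m * P + (K * m + 1) * sum (χ S)  ≡⟨ ∑-*-affine (χ S) (degTo (χ W)) m (K * m + 1) ⟨
        ∑[ v < n ] (χ S v * (m * degTo (χ W) v + (K * m + 1)))
                                         ≤⟨ ∑χ-mono-≤ S (λ v∈S → lowDegree (⊆W v∈S)) ⟩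
        ∑[ v < n ] (χ S v * X)           ≡⟨ ∑χ-* S X ⟩
        s * X                            ∎)
        where
        open LocallyOptimalIn opt
        open ≤-Reasoning
        K = suc k
        m = suc c
        s = ∣ S ∣
        r = ∣ W ∩ ∁ S ∣
        X = degSumIn W + 2 * (K * m)
        P = ⟪ χ S , χ W ⟫

        m≡s+r : m ≡ s + r
        m≡s+r = begin-equality
          m                                         ≡⟨ ∣W∣≡m ⟨
          ∣ W ∣                                     ≡⟨ ∣p∣≡∑χ W ⟩
          sum (χ W)                                 ≡⟨ sum-cong-≗ {n} (χ-∩∁ ⊆W) ⟩
          ∑[ x < n ] (χ S x + χ (W ∩ ∁ S) x)        ≡⟨ ∑-distrib-+ (χ S) (χ (W ∩ ∁ S)) ⟩
          sum (χ S) + sum (χ (W ∩ ∁ S))             ≡⟨ cong₂ _+_ (∣p∣≡∑χ S) (∣p∣≡∑χ (W ∩ ∁ S)) ⟨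
          s + r                                     ∎

        Kr≤P : K * r ≤ P
        Kr≤P = begin
          K * r                                     ≡⟨ *-comm K r ⟩
          r * K                                     ≡⟨ ∑χ-* (W ∩ ∁ S) K ⟨
          ∑[ x < n ] (χ (W ∩ ∁ S) x * K)            ≤⟨ ∑χ-mono-≤ (W ∩ ∁ S) (λ x∈ → let x∈W , x∉S = ∈∩∁⁻ W S x∈ in dominated x∈W x∉S) ⟩
          ⟪ χ (W ∩ ∁ S) , χ S ⟫                     ≡⟨ ⟪⟫-comm (χ (W ∩ ∁ S)) (χ S) ⟩
          ⟪ χ S , χ (W ∩ ∁ S) ⟫                     ≤⟨ ⟪⟫-monoʳ-≤ (χ S) (λ x → ≤-trans (m≤n+m _ (χ S x)) (≤-reflexive (sym (χ-∩∁ ⊆W x)))) ⟩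
          P                                         ∎

        lowDegree : ∀ {v} → v ∈ W → m * degTo (χ W) v + (K * m + 1) ≤ X
        lowDegree {v} v∈W = begin
          m * d + (K * m + 1)              ≡⟨ solve 3 (λ m d K → m :* d :+ (K :* m :+ con 1) := con 1 :+ m :* d :+ K :* m) refl m d K ⟩
          suc (m * d) + K * m              ≤⟨ +-monoˡ-≤ (K * m) (low v∈W) ⟩
          degSumIn W + K * m + K * m       ≡⟨ solve 2 (λ e Km → e :+ Km :+ Km := e :+ con 2 :* Km) refl (degSumIn W) (K * m) ⟩
          X                                ∎
          where d = degTo (χ W) v

      Sparse⇒IsKIndependent : ∀ {S} → Sparse S → IsKIndependent k G S
      Sparse⇒IsKIndependent {S} sparse v v∈S = subst (_≤ k) (sym (degIn-degTo S v)) (sparse v∈S)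

      -- |S| > K m / (e/m + 2K) with denominators cleared, K = k + 1.
      SparseWitness : ℕ → ℕ → Set
      SparseWitness m e = ∃ λ S → Sparse S × suc k * (m * m) < ∣ S ∣ * (e + 2 * (suc k * m))

      sparseWitness : ∀ c W → ∣ W ∣ ≡ suc c → SparseWitness (suc c) (degSumIn W)
      sparseWitness c W ∣W∣≡m
        with any? (λ v → v ∈? W ×-dec degSumIn W + suc k * suc c ≤? suc c * degTo (χ W) v)
      ... | no noHigh with S , opt ← locallyOptimalIn W =
        S , LocallyOptimalIn.sparse opt ,
        locallyOptimal-bound opt ∣W∣≡m (λ v∈W → ≰⇒> λ high → noHigh (_ , v∈W , high))
      sparseWitness zero W _ | yes (v , v∈W , high) =
        contradiction (subst₂ (λ e d → e + suc k * 1 ≤ 1 * d) degSumIn≡ degTo≡ high)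
                      (singleton-not-high-degree (degSumIn W′) Δ k)
        where open VertexRemoval v∈W
      sparseWitness (suc c) W ∣W∣≡m | yes (v , v∈W , high) =
        let S , sparse , ih = sparseWitness c W′ (suc-injective (trans (sym ∣W∣≡) ∣W∣≡m)) in
        S , sparse ,
        subst (λ e → suc k * (m * m) < ∣ S ∣ * (e + 2 * (suc k * m))) (sym degSumIn≡)
          (ratio-step-deletion (suc k) ∣ S ∣ (suc c) (degSumIn W′) Δ
            (subst₂ (λ e d → e + suc k * m ≤ m * d) degSumIn≡ degTo≡ high) ih)
        where
        open VertexRemoval v∈W
        m = suc (suc c)

  sparseWitness-degSum : ∀ k {n} (G : Graph (suc n)) → SparseWitness G k (suc n) (degSum G)
  sparseWitness-degSum k {n} G =
    subst (SparseWitness G k (suc n)) (sym (degSum-degSumIn G)) (sparseWitness G k n ⊤ (∣⊤∣≡n (suc n)))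

  toℚᵘ-ℕ→ℚ : ∀ a → toℚᵘ (ℕ→ℚ a) ℚᵘ.≃ ℚᵘ.mkℚᵘ (ℤ.+ a) 0
  toℚᵘ-ℕ→ℚ a = ℚ.toℚᵘ-fromℚᵘ (ℚᵘ.mkℚᵘ (ℤ.+ a) 0)

  ℕ→ℚ-homo-* : ∀ a b → ℕ→ℚ (a * b) ≡ ℕ→ℚ a ℚ.* ℕ→ℚ b
  ℕ→ℚ-homo-* a b = ℚ.toℚᵘ-injective (begin
    toℚᵘ (ℕ→ℚ (a * b))                          ≈⟨ toℚᵘ-ℕ→ℚ (a * b) ⟩
    ℚᵘ.mkℚᵘ (ℤ.+ (a * b)) 0                     ≈⟨ ℚᵘ.*≡* (cong (ℤ._* ℤ.+ 1) (ℤ.pos-* a b)) ⟩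
    ℚᵘ.mkℚᵘ (ℤ.+ a) 0 ℚᵘ.* ℚᵘ.mkℚᵘ (ℤ.+ b) 0    ≈⟨ ℚᵘ.*-cong (toℚᵘ-ℕ→ℚ a) (toℚᵘ-ℕ→ℚ b) ⟨
    toℚᵘ (ℕ→ℚ a) ℚᵘ.* toℚᵘ (ℕ→ℚ b)              ≈⟨ ℚ.toℚᵘ-homo-* (ℕ→ℚ a) (ℕ→ℚ b) ⟨
    toℚᵘ (ℕ→ℚ a ℚ.* ℕ→ℚ b)                      ∎)
    where open ℚᵘ.≃-Reasoning

  ℕ→ℚ-homo-+ : ∀ a b → ℕ→ℚ (a + b) ≡ ℕ→ℚ a ℚ.+ ℕ→ℚ b
  ℕ→ℚ-homo-+ a b = ℚ.toℚᵘ-injective (begin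
    toℚᵘ (ℕ→ℚ (a + b))                          ≈⟨ toℚᵘ-ℕ→ℚ (a + b) ⟩
    ℚᵘ.mkℚᵘ (ℤ.+ (a + b)) 0                     ≈⟨ ℚᵘ.*≡* (cong (ℤ._* ℤ.+ 1) (trans (ℤ.pos-+ a b)
                                                     (sym (cong₂ ℤ._+_ (ℤ.*-identityʳ (ℤ.+ a)) (ℤ.*-identityʳ (ℤ.+ b)))))) ⟩
    ℚᵘ.mkℚᵘ (ℤ.+ a) 0 ℚᵘ.+ ℚᵘ.mkℚᵘ (ℤ.+ b) 0    ≈⟨ ℚᵘ.+-cong (toℚᵘ-ℕ→ℚ a) (toℚᵘ-ℕ→ℚ b) ⟨
    toℚᵘ (ℕ→ℚ a) ℚᵘ.+ toℚᵘ (ℕ→ℚ b)              ≈⟨ ℚ.toℚᵘ-homo-+ (ℕ→ℚ a) (ℕ→ℚ b) ⟨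
    toℚᵘ (ℕ→ℚ a ℚ.+ ℕ→ℚ b)                      ∎)
    where open ℚᵘ.≃-Reasoning

  ℕ→ℚ-mono-< : ∀ {a b} → a < b → ℕ→ℚ a ℚ.< ℕ→ℚ b
  ℕ→ℚ-mono-< {a} {b} a<b =
    ℚ.toℚᵘ-cancel-< (ℚᵘ.<-respʳ-≃ (ℚᵘ.≃-sym (toℚᵘ-ℕ→ℚ b)) (ℚᵘ.<-respˡ-≃ (ℚᵘ.≃-sym (toℚᵘ-ℕ→ℚ a))
      (ℚᵘ.*<* (subst₂ ℤ._<_ (sym (ℤ.*-identityʳ (ℤ.+ a))) (sym (ℤ.*-identityʳ (ℤ.+ b))) (ℤ.+<+ a<b)))))

  /-*-cancel : ∀ D m → ((ℤ.+ D) / suc m) ℚ.* ℕ→ℚ (suc m) ≡ ℕ→ℚ D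
  /-*-cancel D m = ℚ.toℚᵘ-injective (begin
    toℚᵘ ((ℤ.+ D) / suc m ℚ.* ℕ→ℚ (suc m))
      ≈⟨ ℚ.toℚᵘ-homo-* ((ℤ.+ D) / suc m) (ℕ→ℚ (suc m)) ⟩
    toℚᵘ ((ℤ.+ D) / suc m) ℚᵘ.* toℚᵘ (ℕ→ℚ (suc m))
      ≈⟨ ℚᵘ.*-cong (ℚ.toℚᵘ-fromℚᵘ (ℚᵘ.mkℚᵘ (ℤ.+ D) m)) (toℚᵘ-ℕ→ℚ (suc m)) ⟩
    ℚᵘ.mkℚᵘ (ℤ.+ D) m ℚᵘ.* ℚᵘ.mkℚᵘ (ℤ.+ suc m) 0
      ≈⟨ ℚᵘ.*≡* (trans (ℤ.*-identityʳ _) (cong (λ z → ℤ.+ D ℤ.* ℤ.+ suc z) (sym (*-identityʳ m)))) ⟩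
    ℚᵘ.mkℚᵘ (ℤ.+ D) 0
      ≈⟨ toℚᵘ-ℕ→ℚ D ⟨
    toℚᵘ (ℕ→ℚ D)
      ∎)
    where open ℚᵘ.≃-Reasoning

  bound-< : ∀ k {n} (G : Graph (suc n)) s →
            suc k * (suc n * suc n) < s * (degSum G + 2 * (suc k * suc n)) → bound k G ℚ.< ℕ→ℚ s
  bound-< k {n} G s h = ℚ.*-cancelʳ-<-nonNeg d (ℚ.*-cancelʳ-<-nonNeg m
    (subst₂ ℚ._<_ lhs rhs (ℕ→ℚ-mono-< (subst (λ x → suc k * (suc n * suc n) < s * (degSum G + x)) 2Km≡ h))))
    where
    open ≡-Reasoning
    a = ℕ→ℚ (suc k)
    m = ℕ→ℚ (suc n)
    c = ℕ→ℚ (2 * k + 2)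
    d = avgDeg G ℚ.+ c
    q = ℕ→ℚ s
    instance
      d-pos : ℚ.Positive d
      d-pos = ℚ.nonNeg+pos⇒pos (avgDeg G) {{ℚ.normalize-nonNeg (degSum G) (suc n)}} c
                {{ℚ.normalize-pos (2 * k + 2) 1 {{_}} {{>-nonZero (≤-trans (s≤s z≤n) (m≤n+m 2 (2 * k)))}}}}
      d-nonZero : ℚ.NonZero d
      d-nonZero = ℚ.pos⇒nonZero d
      d-nonNeg : ℚ.NonNegative d
      d-nonNeg = ℚ.pos⇒nonNeg d
      m-nonNeg : ℚ.NonNegative m
      m-nonNeg = ℚ.normalize-nonNeg (suc n) 1
    2Km≡ : 2 * (suc k * suc n) ≡ (2 * k + 2) * suc n
    2Km≡ = solve 2 (λ k n → con 2 :* ((con 1 :+ k) :* (con 1 :+ n)) := (con 2 :* k :+ con 2) :* (con 1 :+ n)) refl k n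
    lhs : ℕ→ℚ (suc k * (suc n * suc n)) ≡ bound k G ℚ.* d ℚ.* m
    lhs = begin
      ℕ→ℚ (suc k * (suc n * suc n))        ≡⟨ trans (ℕ→ℚ-homo-* (suc k) (suc n * suc n))
                                                    (cong (a ℚ.*_) (ℕ→ℚ-homo-* (suc n) (suc n))) ⟩
      a ℚ.* (m ℚ.* m)                      ≡⟨ ℚ.*-identityʳ _ ⟨
      a ℚ.* (m ℚ.* m) ℚ.* 1ℚ               ≡⟨ cong (a ℚ.* (m ℚ.* m) ℚ.*_) (ℚ.*-inverseˡ d) ⟨
      a ℚ.* (m ℚ.* m) ℚ.* (1/ d ℚ.* d)     ≡⟨ ℚ-solve 4 (λ a m i d → a ⊗ (m ⊗ m) ⊗ (i ⊗ d) ⊜ a ⊗ i ⊗ m ⊗ d ⊗ m) refl a m (1/ d) d ⟩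
      bound k G ℚ.* d ℚ.* m                ∎
    rhs : ℕ→ℚ (s * (degSum G + (2 * k + 2) * suc n)) ≡ q ℚ.* d ℚ.* m
    rhs = begin
      ℕ→ℚ (s * (degSum G + (2 * k + 2) * suc n))
        ≡⟨ trans (ℕ→ℚ-homo-* s (degSum G + (2 * k + 2) * suc n)) (cong (q ℚ.*_) (trans (ℕ→ℚ-homo-+ (degSum G) ((2 * k + 2) * suc n))
             (cong₂ ℚ._+_ (sym (/-*-cancel (degSum G) n)) (ℕ→ℚ-homo-* (2 * k + 2) (suc n))))) ⟩
      q ℚ.* (avgDeg G ℚ.* m ℚ.+ c ℚ.* m)
        ≡⟨ ℚ-solve 4 (λ q g c m → q ⊗ (g ⊗ m ⊕ c ⊗ m) ⊜ q ⊗ (g ⊕ c) ⊗ m) refl q (avgDeg G) c m ⟩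
      q ℚ.* d ℚ.* m                        ∎

open SparseSubsets using (Sparse⇒IsKIndependent; sparseWitness-degSum; bound-<)
open import Data.Rational using (_<_)

theorem10 : (k n : ℕ) (G : Graph (suc n)) →
    ∃ λ (S : Subset (suc n)) → IsKIndependent k G S × (bound k G < ℕ→ℚ ∣ S ∣)
theorem10 k n G =
  let S , sparse , large = sparseWitness-degSum k G in
  S , Sparse⇒IsKIndependent G k sparse , bound-< k G ∣ S ∣ large
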